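{- Let $k\ge1$ and $n\ge 2^{k-1}+2$. Then the residues $\{f_w \bmod 2^k : w\in F_{\mathrm{odd}}(n)\}$ are equidistributed in $(\mathbf Z/2^k\mathbf Z)^*$; that is, the numbers $m_i=|\{w\in F_{\mathrm{odd}}(n) : f_w\equiv i \pmod{2^k}\}|$ are equal for all odd integers $1\le i\le 2^k-1$.
   Context: For $n\ge 0$, let $F(n)$ be the set of all words $w=x_1\dotsb x_l$ with each $x_i\in\{1,2\}$ and $\sum_i x_i=n$, and $F=\coprod_{n\ge0}F(n)$ ($F(0)$ contains only the empty word $\emptyset$). The Young–Fibonacci graph has vertex set $F$, with an edge between $v\in F(n)$ and $w\in F(n+1)$ (written $v\in w^-$) iff either (1) $v$ is obtained from $w$ by changing into a $1$ some $2$ of $w$ that has no $1$ to its left, or (2) $v$ is obtained from $w$ by removing its leftmost $1$. The $f$-statistic is defined by $f_\emptyset=1$ and $f_w=\sum_{v\in w^- }f_v$. $F_{\mathrm{odd}}(n)$ is the set of $w\in F(n)$ with $f_w$ odd. -}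

module Defs where

open import Data.Nat using (ℕ; zero; suc; _+_; _^_; _%_)
open import Data.Nat.Properties using (_≟_; m^n≢0)
open import Data.List using (List; []; _∷_; _++_; map; length; filter)
open import Data.Nat.ListAction using (sum)
open import Data.Maybe using (Maybe; just; nothing)
open import Data.Product using (_×_)
open import Relation.Binary.PropositionalEquality using (_≡_)
open import Relation.Nullary.Decidable using (_×-dec_)

data Letter : Set where
  one two : Letter

val : Letter → ℕ
val one = 1
val two = 2

-- Words w = x₁ ⋯ x_l, listed left to right
Word : Set
Word = List Letter

weight : Word → ℕ
weight [] = 0
weight (x ∷ w) = val x + weight w

-- Rule (1): change into a 1 some 2 of w having no 1 to its left.
-- Such 2s are exactly those in the leading block of 2s.
change2 : Word → List Word
change2 [] = []
change2 (one ∷ w) = []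
change2 (two ∷ w) = (one ∷ w) ∷ map (two ∷_) (change2 w)

removeLeftmost1 : Word → Maybe Word
removeLeftmost1 [] = nothing
removeLeftmost1 (one ∷ w) = just w
removeLeftmost1 (two ∷ w) with removeLeftmost1 w
... | just v = just (two ∷ v)
... | nothing = nothing

maybeToList : Maybe Word → List Word
maybeToList (just v) = v ∷ []
maybeToList nothing = []

-- w⁻ : the lower neighbours of w in the Young–Fibonacci graph
-- (the two rules produce words of different lengths, and distinct 2s give
-- distinct words, so this list has no repetitions)
lower : Word → List Word
lower w = change2 w ++ maybeToList (removeLeftmost1 w)

-- f-statistic, f_∅ = 1, f_w = Σ_{v ∈ w⁻} f_v.  The recursion is on the
-- weight (every v ∈ w⁻ has weight |w| - 1); fAux uses it as fuel.
fAux : ℕ → Word → ℕ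
fAux zero w = 1
fAux (suc m) w = sum (map (fAux m) (lower w))

f : Word → ℕ
f w = fAux (weight w) w

-- F(n): enumeration (without repetitions) of all words of weight n
F : ℕ → List Word
F zero = [] ∷ []
F (suc zero) = (one ∷ []) ∷ []
F (suc (suc n)) = map (one ∷_) (F (suc n)) ++ map (two ∷_) (F n)

count : (k n i : ℕ) → ℕ
count k n i =
  length (filter (λ w → ((f w % 2) ≟ 1) ×-dec ((_%_ (f w) (2 ^ k) {{m^n≢0 2 k}}) ≟ i)) (F n))

-- The f-statistic has the closed form f_w = ∏ (1 + weight of the suffix after x_i), the product over
-- the letters x_i = 2 of w. So the odd values of f on F(n), with multiplicity, are the products of the
-- subsets of {1, 3, …, 2m − 1}, m = ⌊n/2⌋, and the hypothesis on n makes 1 + 2^e one of these factors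
-- for 1 ≤ e < k. For odd x, (1 + h) x ≡ x + h (mod 2h), so when 1 + h is a factor the residues t and
-- t + h modulo 2h occur equally often; every odd class modulo h then splits evenly between its two
-- lifts modulo 2h, and induction on k, starting from the trivial modulus 2, gives equidistribution.
module Submission where

open import Defs
open import Data.Nat using (ℕ; zero; suc; _+_; _*_; _∸_; _^_; _%_; _/_; _≤_; _<_; s≤s; NonZero; ⌊_/2⌋)
open import Data.Nat.Properties
open import Data.Nat.DivMod
open import Data.Nat.Divisibility using (m∣m*n; n∣m*n)
open import Data.Nat.ListAction using (sum)
open import Data.Nat.ListAction.Properties using (sum-++)
open import Data.Nat.Tactic.RingSolver using (solve-∀)
open import Algebra.Properties.CommutativeSemigroup +-commutativeSemigroup using (interchange)
open import Algebra.Properties.CommutativeSemigroup *-commutativeSemigroup using () renaming (x∙yz≈y∙xz to *-left-comm)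
open import Data.List using (List; []; _∷_; _++_; [_]; map; length; filter)
open import Data.List.Properties using (map-++; map-∘; map-cong; map-cong-local; filter-++; filter-none; ++-identityʳ)
open import Data.List.Membership.Propositional using (_∈_)
open import Data.List.Membership.Propositional.Properties using (∈-∃++)
open import Data.List.Relation.Unary.All as All using (All; []; _∷_)
open import Data.List.Relation.Unary.All.Properties using (++⁺; ++⁻; map⁺)
open import Data.List.Relation.Unary.Any using (here; there)
open import Data.Bool using (if_then_else_; true; false)
open import Data.Maybe using (just; nothing)
open import Data.Product using (_×_; _,_; proj₁; proj₂)
open import Data.Sum using (_⊎_; inj₁; inj₂)
open import Relation.Nullary using (does; yes; no; contradiction; _×-dec_)
open import Relation.Nullary.Decidable using (dec-true; dec-false)
open import Relation.Unary using (Decidable)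
open import Relation.Binary.PropositionalEquality using (_≡_; _≢_; refl; sym; trans; cong; cong₂; subst; module ≡-Reasoning)
open import Function using (_∘_)

open ≡-Reasoning

n+n≡2*n : ∀ n → n + n ≡ 2 * n
n+n≡2*n n = cong (n +_) (sym (+-identityʳ n))

sum-map-++ : ∀ {A : Set} (φ : A → ℕ) xs ys → sum (map φ (xs ++ ys)) ≡ sum (map φ xs) + sum (map φ ys)
sum-map-++ φ xs ys = trans (cong sum (map-++ φ xs ys)) (sum-++ (map φ xs) (map φ ys))

sum-map-*ˡ : ∀ c ns → sum (map (c *_) ns) ≡ c * sum ns
sum-map-*ˡ c [] = sym (*-zeroʳ c)
sum-map-*ˡ c (n ∷ ns) = trans (cong (c * n +_) (sum-map-*ˡ c ns)) (sym (*-distribˡ-+ c n (sum ns)))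

sum-map-+ : ∀ {A : Set} (φ ψ : A → ℕ) xs → sum (map (λ x → φ x + ψ x) xs) ≡ sum (map φ xs) + sum (map ψ xs)
sum-map-+ φ ψ [] = refl
sum-map-+ φ ψ (x ∷ xs) = trans (cong (φ x + ψ x +_) (sum-map-+ φ ψ xs)) (interchange (φ x) (ψ x) _ _)

length-filter≡sum : ∀ {A : Set} {P : A → Set} (P? : Decidable P) xs →
  length (filter P? xs) ≡ sum (map (λ x → if does (P? x) then 1 else 0) xs)
length-filter≡sum P? [] = refl
length-filter≡sum P? (x ∷ xs) with does (P? x)
... | true  = cong suc (length-filter≡sum P? xs)
... | false = length-filter≡sum P? xs

length-filter-×-dec : ∀ {A B : Set} {P Q : B → Set} (P? : Decidable P) (Q? : Decidable Q) (g : A → B) ys →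
  length (filter (λ y → P? (g y) ×-dec Q? (g y)) ys) ≡ length (filter Q? (filter P? (map g ys)))
length-filter-×-dec P? Q? g [] = refl
length-filter-×-dec P? Q? g (y ∷ ys) with does (P? (g y))
... | false = length-filter-×-dec P? Q? g ys
... | true with does (Q? (g y))
...   | true  = cong suc (length-filter-×-dec P? Q? g ys)
...   | false = length-filter-×-dec P? Q? g ys

filter-map-commute : ∀ {A : Set} {P : A → Set} (P? : Decidable P) {g : A → A} →
  (∀ {x} → P x → P (g x)) → (∀ {x} → P (g x) → P x) →
  ∀ xs → filter P? (map g xs) ≡ map g (filter P? xs)
filter-map-commute P? P⇒Pg Pg⇒P [] = refl
filter-map-commute P? {g} P⇒Pg Pg⇒P (x ∷ xs) with P? (g x) | P? x
... | yes _   | yes _  = cong (g x ∷_) (filter-map-commute P? P⇒Pg Pg⇒P xs)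
... | no _    | no _   = filter-map-commute P? P⇒Pg Pg⇒P xs
... | yes Pgx | no ¬Px = contradiction (Pg⇒P Pgx) ¬Px
... | no ¬Pgx | yes Px = contradiction (P⇒Pg Px) ¬Pgx

Odd : ℕ → Set
Odd x = x % 2 ≡ 1

odd? : Decidable Odd
odd? x = x % 2 ≟ 1

*-odd-%2 : ∀ a x → Odd a → (a * x) % 2 ≡ x % 2
*-odd-%2 a x odd-a = begin
  (a * x) % 2                 ≡⟨ %-distribˡ-* a x 2 ⟩
  (a % 2 * (x % 2)) % 2       ≡⟨ cong (λ r → (r * (x % 2)) % 2) odd-a ⟩
  (1 * (x % 2)) % 2           ≡⟨ cong (_% 2) (*-identityˡ (x % 2)) ⟩
  x % 2 % 2                   ≡⟨ m%n%n≡m%n x 2 ⟩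
  x % 2 ∎

*-even-%2 : ∀ a x → a % 2 ≡ 0 → (a * x) % 2 ≡ 0
*-even-%2 a x even-a = trans (%-distribˡ-* a x 2) (cong (λ r → (r * (x % 2)) % 2) even-a)

odd-1+2n : ∀ n → Odd (suc (2 * n))
odd-1+2n n = trans (cong (λ k → suc k % 2) (*-comm 2 n)) ([m+kn]%n≡m%n 1 n 2)

odd<2⇒≡1 : ∀ {i} → Odd i → i < 2 → i ≡ 1
odd<2⇒≡1 {1} _ _ = refl
odd<2⇒≡1 {suc (suc i)} _ (s≤s (s≤s ()))

n≡2⌊n/2⌋⊎n≡1+2⌊n/2⌋ : ∀ n → n ≡ 2 * ⌊ n /2⌋ ⊎ n ≡ suc (2 * ⌊ n /2⌋)
n≡2⌊n/2⌋⊎n≡1+2⌊n/2⌋ zero = inj₁ refl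
n≡2⌊n/2⌋⊎n≡1+2⌊n/2⌋ (suc zero) = inj₂ refl
n≡2⌊n/2⌋⊎n≡1+2⌊n/2⌋ (suc (suc n)) with n≡2⌊n/2⌋⊎n≡1+2⌊n/2⌋ n
... | inj₁ e = inj₁ (trans (cong (2 +_) e) (sym (*-suc 2 ⌊ n /2⌋)))
... | inj₂ e = inj₂ (trans (cong (2 +_) e) (cong suc (sym (*-suc 2 ⌊ n /2⌋))))

⌊2n/2⌋≡n : ∀ n → ⌊ 2 * n /2⌋ ≡ n
⌊2n/2⌋≡n n = sym (trans (n≡⌊n+n/2⌋ n) (cong ⌊_/2⌋ (n+n≡2*n n)))

-- The product formula for f

fProduct : Word → ℕ
fProduct [] = 1
fProduct (one ∷ w) = fProduct w
fProduct (two ∷ w) = suc (weight w) * fProduct w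

lower-weight : ∀ w → All (λ v → suc (weight v) ≡ weight w) (lower w)
lower-weight w = ++⁺ (change2-weight w) (removeLeftmost1-weight w)
  where
  change2-weight : ∀ w → All (λ v → suc (weight v) ≡ weight w) (change2 w)
  change2-weight [] = []
  change2-weight (one ∷ w) = []
  change2-weight (two ∷ w) = refl ∷ map⁺ (All.map (cong (2 +_)) (change2-weight w))

  removeLeftmost1-weight : ∀ w → All (λ v → suc (weight v) ≡ weight w) (maybeToList (removeLeftmost1 w))
  removeLeftmost1-weight [] = []
  removeLeftmost1-weight (one ∷ w) = refl ∷ []
  removeLeftmost1-weight (two ∷ w) with removeLeftmost1 w | removeLeftmost1-weight w
  ... | just v  | e ∷ [] = cong (2 +_) e ∷ []
  ... | nothing | _      = []

lower-two : ∀ w → lower (two ∷ w) ≡ (one ∷ w) ∷ map (two ∷_) (lower w)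
lower-two w = cong ((one ∷ w) ∷_) (begin
  map (two ∷_) (change2 w) ++ maybeToList (removeLeftmost1 (two ∷ w))
    ≡⟨ cong (map (two ∷_) (change2 w) ++_) (removeLeftmost1-two w) ⟩
  map (two ∷_) (change2 w) ++ map (two ∷_) (maybeToList (removeLeftmost1 w))
    ≡⟨ map-++ (two ∷_) (change2 w) _ ⟨
  map (two ∷_) (lower w) ∎)
  where
  removeLeftmost1-two : ∀ w → maybeToList (removeLeftmost1 (two ∷ w)) ≡ map (two ∷_) (maybeToList (removeLeftmost1 w))
  removeLeftmost1-two w with removeLeftmost1 w
  ... | just v  = refl
  ... | nothing = refl

fProduct-lower : ∀ x w → sum (map fProduct (lower (x ∷ w))) ≡ fProduct (x ∷ w)
fProduct-lower one w = +-identityʳ (fProduct w)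
fProduct-lower two [] = refl
fProduct-lower two v@(y ∷ w) = begin
  sum (map fProduct (lower (two ∷ v)))
    ≡⟨ cong (sum ∘ map fProduct) (lower-two v) ⟩
  fProduct v + sum (map fProduct (map (two ∷_) (lower v)))
    ≡⟨ cong (λ xs → fProduct v + sum xs) (trans (sym (map-∘ (lower v))) (map-cong-local weights)) ⟩
  fProduct v + sum (map ((weight v *_) ∘ fProduct) (lower v))
    ≡⟨ cong (λ xs → fProduct v + sum xs) (map-∘ (lower v)) ⟩
  fProduct v + sum (map (weight v *_) (map fProduct (lower v)))
    ≡⟨ cong (fProduct v +_) (sum-map-*ˡ (weight v) (map fProduct (lower v))) ⟩
  fProduct v + weight v * sum (map fProduct (lower v))
    ≡⟨ cong (λ s → fProduct v + weight v * s) (fProduct-lower y w) ⟩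
  fProduct (two ∷ v) ∎
  where
  weights : All (λ u → suc (weight u) * fProduct u ≡ weight v * fProduct u) (lower v)
  weights = All.map (λ {u} e → cong (_* fProduct u) e) (lower-weight v)

fAux≡fProduct : ∀ m w → weight w ≡ m → fAux m w ≡ fProduct w
fAux≡fProduct zero [] _ = refl
fAux≡fProduct zero (one ∷ w) ()
fAux≡fProduct zero (two ∷ w) ()
fAux≡fProduct (suc m) [] ()
fAux≡fProduct (suc m) (x ∷ w) e = begin
  sum (map (fAux m) (lower (x ∷ w)))
    ≡⟨ cong sum (map-cong-local (All.map (λ e′ → fAux≡fProduct m _ (suc-injective (trans e′ e))) (lower-weight (x ∷ w)))) ⟩
  sum (map fProduct (lower (x ∷ w)))
    ≡⟨ fProduct-lower x w ⟩
  fProduct (x ∷ w) ∎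

f≡fProduct : ∀ w → f w ≡ fProduct w
f≡fProduct w = fAux≡fProduct (weight w) w refl

weight-F : ∀ n → All (λ w → weight w ≡ n) (F n)
weight-F zero = refl ∷ []
weight-F (suc zero) = refl ∷ []
weight-F (suc (suc n)) = ++⁺ (map⁺ (All.map (cong suc) (weight-F (suc n))))
                             (map⁺ (All.map (cong (2 +_)) (weight-F n)))

map-fProduct-F : ∀ n → map fProduct (F (2 + n)) ≡ map fProduct (F (1 + n)) ++ map (suc n *_) (map fProduct (F n))
map-fProduct-F n = begin
  map fProduct (map (one ∷_) (F (1 + n)) ++ map (two ∷_) (F n))
    ≡⟨ map-++ fProduct (map (one ∷_) (F (1 + n))) _ ⟩
  map fProduct (map (one ∷_) (F (1 + n))) ++ map fProduct (map (two ∷_) (F n))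
    ≡⟨ cong₂ _++_ (sym (map-∘ (F (1 + n)))) (trans (sym (map-∘ (F n))) (map-cong-local suc-n-factor)) ⟩
  map fProduct (F (1 + n)) ++ map ((suc n *_) ∘ fProduct) (F n)
    ≡⟨ cong (map fProduct (F (1 + n)) ++_) (map-∘ (F n)) ⟩
  map fProduct (F (1 + n)) ++ map (suc n *_) (map fProduct (F n)) ∎
  where
  suc-n-factor : All (λ w → fProduct (two ∷ w) ≡ suc n * fProduct w) (F n)
  suc-n-factor = All.map (λ {w} e → cong (λ m → suc m * fProduct w) e) (weight-F n)

subsetProducts : List ℕ → List ℕ
subsetProducts [] = [ 1 ]
subsetProducts (a ∷ as) = subsetProducts as ++ map (a *_) (subsetProducts as)

subsetProducts-odd : ∀ {as} → All Odd as → All Odd (subsetProducts as)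
subsetProducts-odd [] = refl ∷ []
subsetProducts-odd {a ∷ as} (odd-a ∷ odd-as) =
  ++⁺ odd-products (map⁺ (All.map (λ {x} odd-x → trans (*-odd-%2 a x odd-a) odd-x) odd-products))
  where
  odd-products : All Odd (subsetProducts as)
  odd-products = subsetProducts-odd odd-as

sum-subsetProducts-∷ : ∀ (φ : ℕ → ℕ) a as →
  sum (map φ (subsetProducts (a ∷ as))) ≡ sum (map φ (subsetProducts as)) + sum (map (φ ∘ (a *_)) (subsetProducts as))
sum-subsetProducts-∷ φ a as =
  trans (sum-map-++ φ (subsetProducts as) _) (cong (sum (map φ (subsetProducts as)) +_) (cong sum (sym (map-∘ (subsetProducts as)))))

sum-subsetProducts-to-front : ∀ (φ : ℕ → ℕ) as a bs →
  sum (map φ (subsetProducts (as ++ a ∷ bs))) ≡ sum (map φ (subsetProducts (a ∷ as ++ bs)))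
sum-subsetProducts-to-front φ [] a bs = refl
sum-subsetProducts-to-front φ (b ∷ as) a bs = begin
  S φ (b ∷ as ++ a ∷ bs)
    ≡⟨ sum-subsetProducts-∷ φ b (as ++ a ∷ bs) ⟩
  S φ (as ++ a ∷ bs) + S (φ ∘ (b *_)) (as ++ a ∷ bs)
    ≡⟨ cong₂ _+_ (sum-subsetProducts-to-front φ as a bs) (sum-subsetProducts-to-front (φ ∘ (b *_)) as a bs) ⟩
  S φ (a ∷ cs) + S (φ ∘ (b *_)) (a ∷ cs)
    ≡⟨ cong₂ _+_ (sum-subsetProducts-∷ φ a cs) (sum-subsetProducts-∷ (φ ∘ (b *_)) a cs) ⟩
  (S φ cs + S (φ ∘ (a *_)) cs) + (S (φ ∘ (b *_)) cs + S (φ ∘ (b *_) ∘ (a *_)) cs)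
    ≡⟨ cong (λ z → (S φ cs + S (φ ∘ (a *_)) cs) + (S (φ ∘ (b *_)) cs + z)) (cong sum (map-cong (λ x → cong φ (*-left-comm b a x)) (subsetProducts cs))) ⟩
  (S φ cs + S (φ ∘ (a *_)) cs) + (S (φ ∘ (b *_)) cs + S (φ ∘ (a *_) ∘ (b *_)) cs)
    ≡⟨ interchange (S φ cs) _ _ _ ⟩
  (S φ cs + S (φ ∘ (b *_)) cs) + (S (φ ∘ (a *_)) cs + S (φ ∘ (a *_) ∘ (b *_)) cs)
    ≡⟨ cong₂ _+_ (sum-subsetProducts-∷ φ b cs) (sum-subsetProducts-∷ (φ ∘ (a *_)) b cs) ⟨
  S φ (b ∷ cs) + S (φ ∘ (a *_)) (b ∷ cs)
    ≡⟨ sum-subsetProducts-∷ φ a (b ∷ cs) ⟨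
  S φ (a ∷ b ∷ cs) ∎
  where
  S : (ℕ → ℕ) → List ℕ → ℕ
  S ψ xs = sum (map ψ (subsetProducts xs))
  cs : List ℕ
  cs = as ++ bs

odds : ℕ → List ℕ
odds zero = []
odds (suc m) = suc (2 * m) ∷ odds m

odds-odd : ∀ m → All Odd (odds m)
odds-odd zero = []
odds-odd (suc m) = odd-1+2n m ∷ odds-odd m

∈-odds : ∀ {x m} → x < m → suc (2 * x) ∈ odds m
∈-odds {x} {suc m} x<1+m with m<1+n⇒m<n∨m≡n x<1+m
... | inj₁ x<m  = there (∈-odds x<m)
... | inj₂ refl = here refl

2^e<⌊n/2⌋ : ∀ {k n e} → 2 ^ k + 2 ≤ n → e < k → 2 ^ e < ⌊ n /2⌋
2^e<⌊n/2⌋ {k} {n} {e} 2^k+2≤n e<k = subst (λ m → suc m ≤ ⌊ n /2⌋) (⌊2n/2⌋≡n (2 ^ e)) (⌊n/2⌋-mono 2+2^[1+e]≤n)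
  where
  2+2^[1+e]≤n : 2 + 2 ^ suc e ≤ n
  2+2^[1+e]≤n = ≤-trans (+-monoʳ-≤ 2 (^-monoʳ-≤ 2 e<k)) (subst (_≤ n) (+-comm (2 ^ k) 2) 2^k+2≤n)

-- The odd values of f

filter-odd-map-*-odd : ∀ a → Odd a → ∀ xs → filter odd? (map (a *_) xs) ≡ map (a *_) (filter odd? xs)
filter-odd-map-*-odd a odd-a = filter-map-commute odd? (λ {x} → trans (*-odd-%2 a x odd-a)) (λ {x} → trans (sym (*-odd-%2 a x odd-a)))

filter-odd-map-*-even : ∀ a → a % 2 ≡ 0 → ∀ xs → filter odd? (map (a *_) xs) ≡ []
filter-odd-map-*-even a even-a xs = filter-none odd? (map⁺ (All.universal (λ x odd → 0≢1+n (trans (sym (*-even-%2 a x even-a)) odd)) xs))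

oddValues : ℕ → List ℕ
oddValues n = filter odd? (map fProduct (F n))

oddValues-step : ∀ n → oddValues (2 + n) ≡ oddValues (1 + n) ++ filter odd? (map (suc n *_) (map fProduct (F n)))
oddValues-step n = trans (cong (filter odd?) (map-fProduct-F n)) (filter-++ odd? (map fProduct (F (1 + n))) _)

oddValues-even-odd : ∀ m → oddValues (2 * m) ≡ subsetProducts (odds m) × oddValues (suc (2 * m)) ≡ subsetProducts (odds m)
oddValues-even-odd zero = refl , refl
oddValues-even-odd (suc m) = trans (cong oddValues (*-suc 2 m)) even-case , trans (cong (oddValues ∘ suc) (*-suc 2 m)) odd-case
  where
  n : ℕ
  n = 2 * m
  ih : oddValues n ≡ subsetProducts (odds m) × oddValues (1 + n) ≡ subsetProducts (odds m)
  ih = oddValues-even-odd m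

  even-case : oddValues (2 + n) ≡ subsetProducts (odds (suc m))
  even-case = begin
    oddValues (2 + n)
      ≡⟨ oddValues-step n ⟩
    oddValues (1 + n) ++ filter odd? (map (suc n *_) (map fProduct (F n)))
      ≡⟨ cong (oddValues (1 + n) ++_) (filter-odd-map-*-odd (1 + n) (odd-1+2n m) (map fProduct (F n))) ⟩
    oddValues (1 + n) ++ map (suc n *_) (oddValues n)
      ≡⟨ cong₂ (λ xs ys → xs ++ map (suc n *_) ys) (proj₂ ih) (proj₁ ih) ⟩
    subsetProducts (odds (suc m)) ∎

  odd-case : oddValues (3 + n) ≡ subsetProducts (odds (suc m))
  odd-case = begin
    oddValues (3 + n)
      ≡⟨ oddValues-step (1 + n) ⟩
    oddValues (2 + n) ++ filter odd? (map ((2 + n) *_) (map fProduct (F (1 + n))))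
      ≡⟨ cong (oddValues (2 + n) ++_) (filter-odd-map-*-even (2 + n) even-2+n (map fProduct (F (1 + n)))) ⟩
    oddValues (2 + n) ++ []
      ≡⟨ ++-identityʳ (oddValues (2 + n)) ⟩
    oddValues (2 + n)
      ≡⟨ even-case ⟩
    subsetProducts (odds (suc m)) ∎
    where
    even-2+n : (2 + n) % 2 ≡ 0
    even-2+n = trans (cong (_% 2) (trans (sym (*-suc 2 m)) (*-comm 2 (suc m)))) (m*n%n≡0 (suc m) 2)

oddValues≡subsetProducts : ∀ n → oddValues n ≡ subsetProducts (odds ⌊ n /2⌋)
oddValues≡subsetProducts n with n≡2⌊n/2⌋⊎n≡1+2⌊n/2⌋ n
... | inj₁ e = trans (cong oddValues e) (proj₁ (oddValues-even-odd ⌊ n /2⌋))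
... | inj₂ e = trans (cong oddValues e) (proj₂ (oddValues-even-odd ⌊ n /2⌋))

δ : ℕ → ℕ → ℕ
δ a b = if does (a ≟ b) then 1 else 0

δ-≡ : ∀ {a b} → a ≡ b → δ a b ≡ 1
δ-≡ {a} {b} a≡b = cong (if_then 1 else 0) (dec-true (a ≟ b) a≡b)

δ-≢ : ∀ {a b} → a ≢ b → δ a b ≡ 0
δ-≢ {a} {b} a≢b = cong (if_then 1 else 0) (dec-false (a ≟ b) a≢b)

δ-+-cancelʳ : ∀ a b c → δ (a + c) (b + c) ≡ δ a b
δ-+-cancelʳ a b c with a ≟ b
... | yes a≡b = trans (δ-≡ (cong (_+ c) a≡b)) (sym (δ-≡ a≡b))
... | no a≢b  = trans (δ-≢ (a≢b ∘ +-cancelʳ-≡ c a b)) (sym (δ-≢ a≢b))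

countMod : (M : ℕ) .{{_ : NonZero M}} → ℕ → List ℕ → ℕ
countMod M t xs = sum (map (λ x → δ (x % M) t) xs)

count≡countMod-subsetProducts : ∀ k n i → count k n i ≡ countMod (2 ^ k) {{m^n≢0 2 k}} i (subsetProducts (odds ⌊ n /2⌋))
count≡countMod-subsetProducts k n i = begin
  count k n i
    ≡⟨ length-filter-×-dec odd? ≡i? f (F n) ⟩
  length (filter ≡i? (filter odd? (map f (F n))))
    ≡⟨ cong (λ xs → length (filter ≡i? (filter odd? xs))) (map-cong f≡fProduct (F n)) ⟩
  length (filter ≡i? (oddValues n))
    ≡⟨ length-filter≡sum ≡i? (oddValues n) ⟩
  countMod (2 ^ k) i (oddValues n)
    ≡⟨ cong (countMod (2 ^ k) i) (oddValues≡subsetProducts n) ⟩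
  countMod (2 ^ k) i (subsetProducts (odds ⌊ n /2⌋)) ∎
  where
  instance
    2^k-nonZero : NonZero (2 ^ k)
    2^k-nonZero = m^n≢0 2 k
  ≡i? : Decidable (λ x → x % 2 ^ k ≡ i)
  ≡i? x = x % 2 ^ k ≟ i

-- Equidistribution of subset products of odd numbers

module _ (h : ℕ) .{{_ : NonZero h}} where
  private
    instance
      2h-nonZero : NonZero (2 * h)
      2h-nonZero = m*n≢0 2 h

    2h≡h+h : 2 * h ≡ h + h
    2h≡h+h = sym (n+n≡2*n h)

    data Half : ℕ → Set where
      low  : ∀ {s} → s < h → Half s
      high : ∀ {s} → s < h → Half (s + h)

    half : ∀ {r} → r < 2 * h → Half r
    half {r} r<2h with r <? h
    ... | yes r<h = low r<h
    ... | no r≮h  = subst Half (m∸n+n≡m (≮⇒≥ r≮h)) (high (m<n+o⇒m∸n<o r h (subst (r <_) 2h≡h+h r<2h)))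

    s+h<2h : ∀ {s} → s < h → s + h < 2 * h
    s+h<2h {s} s<h = subst (s + h <_) (sym 2h≡h+h) (+-monoˡ-< h s<h)

    [s+h+h]%2h≡s : ∀ {s} → s < h → (s + h + h) % (2 * h) ≡ s
    [s+h+h]%2h≡s {s} s<h = begin
      (s + h + h) % (2 * h)   ≡⟨ cong (_% (2 * h)) (trans (+-assoc s h h) (cong (s +_) (sym 2h≡h+h))) ⟩
      (s + 2 * h) % (2 * h)   ≡⟨ [m+n]%n≡m%n s (2 * h) ⟩
      s % (2 * h)             ≡⟨ m<n⇒m%n≡m (<-≤-trans s<h (m≤n*m h 2)) ⟩
      s ∎

    δ-below-high : ∀ {s} t → s < h → δ s (t + h) ≡ 0
    δ-below-high {s} t s<h = δ-≢ (<⇒≢ (<-≤-trans s<h (m≤n+m h t)))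

    δ-high-below : ∀ s {t} → t < h → δ (s + h) t ≡ 0
    δ-high-below s {t} t<h = δ-≢ (>⇒≢ (<-≤-trans t<h (m≤n+m h s)))

    δ-%h : ∀ {r t} → r < 2 * h → t < h → δ (r % h) t ≡ δ r t + δ r (t + h)
    δ-%h {t = t} r<2h t<h with half r<2h
    ... | low {s} s<h = begin
      δ (s % h) t           ≡⟨ cong (λ u → δ u t) (m<n⇒m%n≡m s<h) ⟩
      δ s t                 ≡⟨ +-identityʳ (δ s t) ⟨
      δ s t + 0             ≡⟨ cong (δ s t +_) (δ-below-high t s<h) ⟨
      δ s t + δ s (t + h)   ∎
    ... | high {s} s<h = begin
      δ ((s + h) % h) t                 ≡⟨ cong (λ u → δ u t) (trans ([m+n]%n≡m%n s h) (m<n⇒m%n≡m s<h)) ⟩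
      δ s t                             ≡⟨ δ-+-cancelʳ s t h ⟨
      δ (s + h) (t + h)                 ≡⟨ cong (_+ δ (s + h) (t + h)) (δ-high-below s t<h) ⟨
      δ (s + h) t + δ (s + h) (t + h)   ∎

    δ-+h : ∀ {r t} → r < 2 * h → t < h →
      δ ((r + h) % (2 * h)) t ≡ δ r (t + h) × δ ((r + h) % (2 * h)) (t + h) ≡ δ r t
    δ-+h {t = t} r<2h t<h with half r<2h
    ... | low {s} s<h rewrite m<n⇒m%n≡m (s+h<2h s<h) =
      trans (δ-high-below s t<h) (sym (δ-below-high t s<h)) , δ-+-cancelʳ s t h
    ... | high {s} s<h rewrite [s+h+h]%2h≡s s<h =
      sym (δ-+-cancelʳ s t h) , trans (δ-below-high t s<h) (sym (δ-high-below s t<h))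

    suc-h*x%2h : ∀ {x} → Odd x → (suc h * x) % (2 * h) ≡ (x % (2 * h) + h) % (2 * h)
    suc-h*x%2h {x} odd-x = begin
      (suc h * x) % (2 * h)                       ≡⟨ cong (λ y → (suc h * y) % (2 * h)) x≡1+2q ⟩
      (suc h * (1 + q * 2)) % (2 * h)             ≡⟨ cong (_% (2 * h)) (expand h q) ⟩
      (1 + q * 2 + h + q * (2 * h)) % (2 * h)     ≡⟨ [m+kn]%n≡m%n (1 + q * 2 + h) q (2 * h) ⟩
      (1 + q * 2 + h) % (2 * h)                   ≡⟨ cong (λ y → (y + h) % (2 * h)) x≡1+2q ⟨
      (x + h) % (2 * h)                           ≡⟨ %-distribˡ-+ x h (2 * h) ⟩
      (x % (2 * h) + h % (2 * h)) % (2 * h)       ≡⟨ cong (λ y → (y + h % (2 * h)) % (2 * h)) (m%n%n≡m%n x (2 * h)) ⟨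
      (x % (2 * h) % (2 * h) + h % (2 * h)) % (2 * h)  ≡⟨ %-distribˡ-+ (x % (2 * h)) h (2 * h) ⟨
      (x % (2 * h) + h) % (2 * h) ∎
      where
      q : ℕ
      q = x / 2
      x≡1+2q : x ≡ 1 + q * 2
      x≡1+2q = trans (m≡m%n+[m/n]*n x 2) (cong (_+ q * 2) odd-x)
      expand : ∀ h q → suc h * (1 + q * 2) ≡ 1 + q * 2 + h + q * (2 * h)
      expand = solve-∀

  countMod-halve : ∀ {t} → t < h → ∀ xs → countMod h t xs ≡ countMod (2 * h) t xs + countMod (2 * h) (t + h) xs
  countMod-halve {t} t<h xs = trans (cong sum (map-cong δ-x%h xs)) (sum-map-+ _ _ xs)
    where
    δ-x%h : ∀ x → δ (x % h) t ≡ δ (x % (2 * h)) t + δ (x % (2 * h)) (t + h)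
    δ-x%h x = trans (cong (λ u → δ u t) (sym (m∣n⇒o%n%m≡o%m h (2 * h) x (n∣m*n 2)))) (δ-%h (m%n<n x (2 * h)) t<h)

  countMod-map-suc-h* : ∀ {t} → t < h → ∀ {xs} → All Odd xs →
    sum (map (λ x → δ ((suc h * x) % (2 * h)) t) xs) ≡ countMod (2 * h) (t + h) xs ×
    sum (map (λ x → δ ((suc h * x) % (2 * h)) (t + h)) xs) ≡ countMod (2 * h) t xs
  countMod-map-suc-h* {t} t<h odd-xs =
    cong sum (map-cong-local (All.map (λ {x} odd-x → trans (cong (λ u → δ u t) (suc-h*x%2h odd-x)) (proj₁ (δ-+h (m%n<n x (2 * h)) t<h))) odd-xs)) ,
    cong sum (map-cong-local (All.map (λ {x} odd-x → trans (cong (λ u → δ u (t + h)) (suc-h*x%2h odd-x)) (proj₂ (δ-+h (m%n<n x (2 * h)) t<h))) odd-xs))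

  -- The subset products pair up as p, (1 + h) p, and multiplication by 1 + h
  -- swaps the odd residues t and t + h modulo 2 h.
  countMod-subsetProducts-symmetric : ∀ {as} → All Odd as → suc h ∈ as →
    ∀ {t} → t < h → countMod (2 * h) t (subsetProducts as) ≡ countMod (2 * h) (t + h) (subsetProducts as)
  countMod-subsetProducts-symmetric odd-as 1+h∈as {t} t<h with ∈-∃++ 1+h∈as
  ... | bs , cs , refl = begin
    countMod (2 * h) t (subsetProducts (bs ++ suc h ∷ cs))
      ≡⟨ sum-subsetProducts-to-front _ bs (suc h) cs ⟩
    countMod (2 * h) t (subsetProducts (suc h ∷ bs ++ cs))
      ≡⟨ sum-subsetProducts-∷ _ (suc h) (bs ++ cs) ⟩
    countMod (2 * h) t P + sum (map (λ x → δ ((suc h * x) % (2 * h)) t) P)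
      ≡⟨ cong (countMod (2 * h) t P +_) (proj₁ (countMod-map-suc-h* t<h odd-P)) ⟩
    countMod (2 * h) t P + countMod (2 * h) (t + h) P
      ≡⟨ +-comm (countMod (2 * h) t P) _ ⟩
    countMod (2 * h) (t + h) P + countMod (2 * h) t P
      ≡⟨ cong (countMod (2 * h) (t + h) P +_) (proj₂ (countMod-map-suc-h* t<h odd-P)) ⟨
    countMod (2 * h) (t + h) P + sum (map (λ x → δ ((suc h * x) % (2 * h)) (t + h)) P)
      ≡⟨ sum-subsetProducts-∷ _ (suc h) (bs ++ cs) ⟨
    countMod (2 * h) (t + h) (subsetProducts (suc h ∷ bs ++ cs))
      ≡⟨ sum-subsetProducts-to-front _ bs (suc h) cs ⟨
    countMod (2 * h) (t + h) (subsetProducts (bs ++ suc h ∷ cs)) ∎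
    where
    P : List ℕ
    P = subsetProducts (bs ++ cs)
    odd-P : All Odd P
    odd-P with ++⁻ bs odd-as
    ... | odd-bs , _ ∷ odd-cs = subsetProducts-odd (++⁺ odd-bs odd-cs)

  countMod-double : ∀ xs → (∀ {t} → t < h → countMod (2 * h) t xs ≡ countMod (2 * h) (t + h) xs) →
    ∀ {i} → i < 2 * h → countMod h (i % h) xs ≡ 2 * countMod (2 * h) i xs
  countMod-double xs symmetric i<2h with half i<2h
  ... | low {t} t<h = begin
    countMod h (t % h) xs                               ≡⟨ cong (λ u → countMod h u xs) (m<n⇒m%n≡m t<h) ⟩
    countMod h t xs                                     ≡⟨ countMod-halve t<h xs ⟩
    countMod (2 * h) t xs + countMod (2 * h) (t + h) xs ≡⟨ cong (countMod (2 * h) t xs +_) (symmetric t<h) ⟨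
    countMod (2 * h) t xs + countMod (2 * h) t xs       ≡⟨ n+n≡2*n (countMod (2 * h) t xs) ⟩
    2 * countMod (2 * h) t xs                           ∎
  ... | high {t} t<h = begin
    countMod h ((t + h) % h) xs                               ≡⟨ cong (λ u → countMod h u xs) (trans ([m+n]%n≡m%n t h) (m<n⇒m%n≡m t<h)) ⟩
    countMod h t xs                                           ≡⟨ countMod-halve t<h xs ⟩
    countMod (2 * h) t xs + countMod (2 * h) (t + h) xs       ≡⟨ cong (_+ countMod (2 * h) (t + h) xs) (symmetric t<h) ⟩
    countMod (2 * h) (t + h) xs + countMod (2 * h) (t + h) xs ≡⟨ n+n≡2*n (countMod (2 * h) (t + h) xs) ⟩
    2 * countMod (2 * h) (t + h) xs                           ∎

subsetProducts-equidistributed : ∀ k {as} → All Odd as → (∀ {e} → e < k → suc (2 ^ suc e) ∈ as) →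
  ∀ {i j} → Odd i → Odd j → i < 2 ^ suc k → j < 2 ^ suc k →
  countMod (2 ^ suc k) {{m^n≢0 2 (suc k)}} i (subsetProducts as) ≡ countMod (2 ^ suc k) {{m^n≢0 2 (suc k)}} j (subsetProducts as)
subsetProducts-equidistributed zero {as} _ _ odd-i odd-j i<2 j<2 =
  cong (λ u → countMod 2 u (subsetProducts as)) (trans (odd<2⇒≡1 odd-i i<2) (sym (odd<2⇒≡1 odd-j j<2)))
subsetProducts-equidistributed (suc k) {as} odd-as 1+2^e∈as {i} {j} odd-i odd-j i<2h j<2h =
  *-cancelˡ-≡ _ _ 2 (begin
    2 * countMod (2 * h) i (subsetProducts as)  ≡⟨ countMod-double h (subsetProducts as) symmetric i<2h ⟨
    countMod h (i % h) (subsetProducts as)      ≡⟨ equidistributed-mod-h ⟩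
    countMod h (j % h) (subsetProducts as)      ≡⟨ countMod-double h (subsetProducts as) symmetric j<2h ⟩
    2 * countMod (2 * h) j (subsetProducts as)  ∎)
  where
  h : ℕ
  h = 2 ^ suc k
  instance
    h-nonZero : NonZero h
    h-nonZero = m^n≢0 2 (suc k)
    2h-nonZero : NonZero (2 * h)
    2h-nonZero = m^n≢0 2 (suc (suc k))
  symmetric : ∀ {t} → t < h → countMod (2 * h) t (subsetProducts as) ≡ countMod (2 * h) (t + h) (subsetProducts as)
  symmetric = countMod-subsetProducts-symmetric h odd-as (1+2^e∈as (n<1+n k))
  odd-%h : ∀ {x} → Odd x → Odd (x % h)
  odd-%h {x} odd-x = trans (m∣n⇒o%n%m≡o%m 2 h x (m∣m*n (2 ^ k))) odd-x
  equidistributed-mod-h : countMod h (i % h) (subsetProducts as) ≡ countMod h (j % h) (subsetProducts as)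
  equidistributed-mod-h = subsetProducts-equidistributed k odd-as (λ e<k → 1+2^e∈as (m<n⇒m<1+n e<k))
    (odd-%h odd-i) (odd-%h odd-j) (m%n<n i h) (m%n<n j h)

mainTheorem8 : (k n : ℕ) → 1 ≤ k → 2 ^ (k ∸ 1) + 2 ≤ n →
    (i j : ℕ) → i % 2 ≡ 1 → j % 2 ≡ 1 → i < 2 ^ k → j < 2 ^ k →
    count k n i ≡ count k n j
mainTheorem8 zero _ () _ _ _ _ _ _ _
mainTheorem8 (suc k) n _ 2^k+2≤n i j odd-i odd-j i<2^k j<2^k = begin
  count (suc k) n i
    ≡⟨ count≡countMod-subsetProducts (suc k) n i ⟩
  countMod (2 ^ suc k) {{m^n≢0 2 (suc k)}} i (subsetProducts (odds ⌊ n /2⌋))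
    ≡⟨ subsetProducts-equidistributed k (odds-odd ⌊ n /2⌋) (λ e<k → ∈-odds (2^e<⌊n/2⌋ 2^k+2≤n e<k)) odd-i odd-j i<2^k j<2^k ⟩
  countMod (2 ^ suc k) {{m^n≢0 2 (suc k)}} j (subsetProducts (odds ⌊ n /2⌋))
    ≡⟨ count≡countMod-subsetProducts (suc k) n j ⟨
  count (suc k) n j ∎
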